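{- For any integers $n \ge d \ge 1$ and $m \ge 1$, $$P(n+m,d) \ge \max_{A \in Q(n+m,m,d)} \sum_{\sigma \in A} P_d(\sigma^C).$$
   Context: For a finite set $\Sigma$ of positive integers, a permutation over $\Sigma$ is a sequence listing each element of $\Sigma$ exactly once. The Chebyshev distance between two sequences $\sigma,\pi$ of the same length is $\max_i |\sigma(i)-\pi(i)|$ over positions $i$. $P_d(\Sigma)$ is the maximum cardinality of a set of permutations over $\Sigma$ in which any two distinct members have Chebyshev distance at least $d$, and $P(N,d)=P_d(\{1,\dots,N\})$. For positive integers $N,m,d$, $Q(N,m,d)$ is the collection of all sets $A$ of length-$m$ sequences of pairwise distinct symbols from $\{1,\dots,N\}$ such that any two distinct members of $A$ have Chebyshev distance at least $d$. For such a sequence $\sigma$ (here with $N=n+m$), $\sigma^C$ denotes the set $\{1,\dots,n+m\}$ minus the symbols occurring in $\sigma$. -}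

module Defs where

open import Data.Nat using (ℕ; zero; suc; _≤_; _⊔_; ∣_-_∣; _≟_)
open import Data.List using (List; []; _∷_; length; map; filter; upTo)
open import Data.List.Membership.Propositional using (_∈_)
open import Data.List.Membership.DecPropositional _≟_ using (_∈?_)
open import Data.List.Relation.Unary.All using (All)
open import Data.List.Relation.Unary.AllPairs using (AllPairs)
open import Data.List.Relation.Unary.Unique.Propositional using (Unique)
open import Data.Product using (Σ; _×_)
open import Relation.Binary.PropositionalEquality using (_≡_)
open import Relation.Nullary.Decidable using (¬?)
open import Function.Bundles using (_⇔_)

-- Chebyshev distance max_i |σ(i) - π(i)| of two sequences
-- (only ever applied to sequences of equal length).
cheb : List ℕ → List ℕ → ℕ
cheb (x ∷ xs) (y ∷ ys) = ∣ x - y ∣ ⊔ cheb xs ys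
cheb _ _ = 0

-- finite sets of positive integers are represented by lists (membership only)
-- {1, …, N}
range : ℕ → List ℕ
range N = map suc (upTo N)

IsPermOver : List ℕ → List ℕ → Set
IsPermOver S π = Unique π × (∀ x → (x ∈ π) ⇔ (x ∈ S))

IsDistCode : ℕ → List (List ℕ) → Set
IsDistCode d C = Unique C × AllPairs (λ a b → d ≤ cheb a b) C

IsPermCode : ℕ → List ℕ → List (List ℕ) → Set
IsPermCode d S C = All (IsPermOver S) C × IsDistCode d C

IsPd : ℕ → List ℕ → ℕ → Set
IsPd d S k = Σ (List (List ℕ)) (λ C → IsPermCode d S C × length C ≡ k)
           × (∀ C → IsPermCode d S C → length C ≤ k)

IsP : ℕ → ℕ → ℕ → Set
IsP N d k = IsPd d (range N) k

IsPartialSeq : ℕ → ℕ → List ℕ → Set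
IsPartialSeq N m σ = length σ ≡ m × Unique σ × All (λ x → 1 ≤ x × x ≤ N) σ

InQ : ℕ → ℕ → ℕ → List (List ℕ) → Set
InQ N m d A = All (IsPartialSeq N m) A × IsDistCode d A

compl : ℕ → List ℕ → List ℕ
compl N σ = filter (λ x → ¬? (x ∈? σ)) (range N)

{-# OPTIONS --safe #-}
-- Let N = n + m. Choose for every prefix σ ∈ A an optimal code C_σ of permutations of σ^C
-- with minimum distance d. The sequences σ ++ π with σ ∈ A and π ∈ C_σ are permutations of
-- {1,…,N}; two of them with the same prefix are as far apart as their suffixes, and two with
-- different prefixes are at least as far apart as their prefixes, because all prefixes have the
-- same length m. So they form a code for P(N,d) of size Σ_{σ ∈ A} P_d(σ^C).
module Submission where

open import Defs
open import Data.Nat using (ℕ; suc; _+_; _≤_; _⊔_; ∣_-_∣; s≤s; z≤n; _≟_)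
open import Data.Nat.Properties using (∣n-n∣≡0; ⊔-monoʳ-≤; suc-injective; ≤-trans; ≤-reflexive; module ≤-Reasoning)
open import Data.List using (List; []; _∷_; map; _++_; length; concatMap)
open import Data.List.Properties using (length-++; length-map; ≡-dec)
open import Data.Nat.ListAction using (sum)
open import Data.List.Membership.Propositional using (_∈_; _∉_)
open import Data.List.Membership.Propositional.Properties
  using (∈-map⁺; ∈-upTo⁺; ∈-filter⁺; ∈-filter⁻; ∈-++⁺ˡ; ∈-++⁺ʳ; ∈-++⁻)
import Data.List.Membership.DecPropositional as DecMembership
open import Data.List.Relation.Unary.All as All using (All; []; _∷_)
import Data.List.Relation.Unary.All.Properties as All
open import Data.List.Relation.Unary.AllPairs as AllPairs using (AllPairs; []; _∷_)
import Data.List.Relation.Unary.AllPairs.Properties as AllPairs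
open import Data.List.Relation.Unary.Unique.Propositional using (Unique)
import Data.List.Relation.Unary.Unique.Propositional.Properties as Unique
open import Data.Product using (Σ; _×_; _,_; proj₁; proj₂)
open import Data.Sum using (inj₁; inj₂)
open import Relation.Nullary using (¬_; yes; no; ¬?; contradiction)
open import Relation.Binary.Definitions using (DecidableEquality)
open import Relation.Binary.PropositionalEquality using (_≡_; refl; sym; trans; cong₂)
open import Function using (_∘_; _∘′_)
open import Function.Bundles using (mk⇔; Equivalence)

open DecMembership _≟_ using (_∈?_)

finite-choice : {X Y : Set} {P : X → Y → Set} → DecidableEquality X → Y
              → (A : List X) → (∀ x → x ∈ A → Σ Y (P x))
              → Σ (X → Y) (λ g → All (λ x → P x (g x)) A)
finite-choice {X} {Y} {P} _≟X_ default A choose = g , All.tabulate g-spec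
  where
  open DecMembership _≟X_ using () renaming (_∈?_ to _∈A?_)
  g : X → Y
  g x with x ∈A? A
  ... | yes x∈A = proj₁ (choose x x∈A)
  ... | no _    = default
  g-spec : ∀ {x} → x ∈ A → P x (g x)
  g-spec {x} x∈A with x ∈A? A
  ... | yes x∈A′ = proj₂ (choose x x∈A′)
  ... | no x∉A   = contradiction x∈A x∉A

All-≡⇒AllPairs-≡ : {X : Set} {g : X → ℕ} {c : ℕ} {xs : List X}
                 → All (λ x → g x ≡ c) xs → AllPairs (λ x y → g x ≡ g y) xs
All-≡⇒AllPairs-≡ []       = []
All-≡⇒AllPairs-≡ (p ∷ ps) = All.map (λ q → trans p (sym q)) ps ∷ All-≡⇒AllPairs-≡ ps

Far : ℕ → List ℕ → List ℕ → Set
Far d σ τ = d ≤ cheb σ τ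

cheb-self≡0 : ∀ σ → cheb σ σ ≡ 0
cheb-self≡0 []      = refl
cheb-self≡0 (x ∷ σ) = cong₂ _⊔_ (∣n-n∣≡0 x) (cheb-self≡0 σ)

cheb-++ˡ : ∀ σ π π′ → cheb (σ ++ π) (σ ++ π′) ≡ cheb π π′
cheb-++ˡ []      π π′ = refl
cheb-++ˡ (x ∷ σ) π π′ rewrite ∣n-n∣≡0 x = cheb-++ˡ σ π π′

cheb-≤-++ : ∀ σ τ π π′ → length σ ≡ length τ → cheb σ τ ≤ cheb (σ ++ π) (τ ++ π′)
cheb-≤-++ []      []      π π′ _  = z≤n
cheb-≤-++ (x ∷ σ) (y ∷ τ) π π′ eq = ⊔-monoʳ-≤ ∣ x - y ∣ (cheb-≤-++ σ τ π π′ (suc-injective eq))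

Far⇒Unique : ∀ {d C} → 1 ≤ d → AllPairs (Far d) C → Unique C
Far⇒Unique {d} 1≤d = AllPairs.map far⇒≢
  where
  far⇒≢ : ∀ {σ τ} → Far d σ τ → ¬ σ ≡ τ
  far⇒≢ {σ} far refl with ≤-trans 1≤d (≤-trans far (≤-reflexive (cheb-self≡0 σ)))
  ... | ()

∈-range⁺ : ∀ {N x} → 1 ≤ x → x ≤ N → x ∈ range N
∈-range⁺ {x = suc k} (s≤s z≤n) k<N = ∈-map⁺ suc (∈-upTo⁺ k<N)

module _ {N : ℕ} {σ : List ℕ} where

  ∈-compl⁻ : ∀ {x} → x ∈ compl N σ → x ∈ range N × x ∉ σ
  ∈-compl⁻ = ∈-filter⁻ (λ x → ¬? (x ∈? σ))

  ∈-compl⁺ : ∀ {x} → x ∈ range N → x ∉ σ → x ∈ compl N σ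
  ∈-compl⁺ = ∈-filter⁺ (λ x → ¬? (x ∈? σ))

  ++-isPermOver-range : Unique σ → All (λ x → 1 ≤ x × x ≤ N) σ
                      → ∀ {π} → IsPermOver (compl N σ) π → IsPermOver (range N) (σ ++ π)
  ++-isPermOver-range σ-unique σ-bounded {π} (π-unique , π-perm) =
    Unique.++⁺ σ-unique π-unique disjoint , λ x → mk⇔ (sound x) (complete x)
    where
    ∈-compl : ∀ {x} → x ∈ π → x ∈ compl N σ
    ∈-compl = Equivalence.to (π-perm _)
    disjoint : ∀ {x} → ¬ (x ∈ σ × x ∈ π)
    disjoint (x∈σ , x∈π) = proj₂ (∈-compl⁻ (∈-compl x∈π)) x∈σ
    sound : ∀ x → x ∈ σ ++ π → x ∈ range N
    sound x x∈ with ∈-++⁻ σ x∈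
    ... | inj₁ x∈σ = let (1≤x , x≤N) = All.lookup σ-bounded x∈σ in ∈-range⁺ 1≤x x≤N
    ... | inj₂ x∈π = proj₁ (∈-compl⁻ (∈-compl x∈π))
    complete : ∀ x → x ∈ range N → x ∈ σ ++ π
    complete x x∈N with x ∈? σ
    ... | yes x∈σ = ∈-++⁺ˡ x∈σ
    ... | no  x∉σ = ∈-++⁺ʳ σ (Equivalence.from (π-perm x) (∈-compl⁺ x∈N x∉σ))

extensions : (List ℕ → List (List ℕ)) → List (List ℕ) → List (List ℕ)
extensions code = concatMap (λ σ → map (σ ++_) (code σ))

module _ (code : List ℕ → List (List ℕ)) where

  length-extensions : ∀ {f} A → All (λ σ → length (code σ) ≡ f σ) A
                    → length (extensions code A) ≡ sum (map f A)
  length-extensions []      []         = refl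
  length-extensions (σ ∷ A) (eq ∷ eqs) =
    trans (length-++ (map (σ ++_) (code σ)))
          (cong₂ _+_ (trans (length-map (σ ++_) (code σ)) eq) (length-extensions A eqs))

  All-extensions : ∀ {P : List ℕ → Set} {A}
                 → All (λ σ → All (λ π → P (σ ++ π)) (code σ)) A → All P (extensions code A)
  All-extensions = All.concat⁺ ∘′ All.map⁺ ∘′ All.map All.map⁺

  AllPairs-extensions : ∀ {d A}
    → AllPairs (λ σ τ → Far d σ τ × length σ ≡ length τ) A
    → All (λ σ → AllPairs (Far d) (code σ)) A
    → AllPairs (Far d) (extensions code A)
  AllPairs-extensions {d} prefixes-far codes-far =
    AllPairs.concat⁺ (All.map⁺ (All.map same-prefix codes-far))
                     (AllPairs.map⁺ (AllPairs.map different-prefixes prefixes-far))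
    where
    same-prefix : ∀ {σ} → AllPairs (Far d) (code σ) → AllPairs (Far d) (map (σ ++_) (code σ))
    same-prefix {σ} = AllPairs.map⁺ ∘ AllPairs.map λ {π} {π′} far →
      ≤-trans far (≤-reflexive (sym (cheb-++ˡ σ π π′)))
    different-prefixes : ∀ {σ τ} → Far d σ τ × length σ ≡ length τ
      → All (λ s → All (Far d s) (map (τ ++_) (code τ))) (map (σ ++_) (code σ))
    different-prefixes {σ} {τ} (far , eq) =
      All.map⁺ (All.tabulate λ {π} _ → All.map⁺ (All.tabulate λ {π′} _ →
        ≤-trans far (cheb-≤-++ σ τ π π′ eq)))

  extensions-isPermCode : ∀ {N m d A} → 1 ≤ d → InQ N m d A
    → All (λ σ → IsPermCode d (compl N σ) (code σ)) A
    → IsPermCode d (range N) (extensions code A)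
  extensions-isPermCode {N} {m} {d} {A} 1≤d (prefixes , _ , prefixes-far) codes =
    All-extensions (All.zipWith perms (prefixes , codes)) ,
    Far⇒Unique 1≤d far , far
    where
    perms : ∀ {σ} → IsPartialSeq N m σ × IsPermCode d (compl N σ) (code σ)
          → All (λ π → IsPermOver (range N) (σ ++ π)) (code σ)
    perms ((_ , unique , bounded) , code-perms , _) =
      All.map (++-isPermOver-range unique bounded) code-perms
    lengths : AllPairs (λ σ τ → length σ ≡ length τ) A
    lengths = All-≡⇒AllPairs-≡ (All.map proj₁ prefixes)
    far : AllPairs (Far d) (extensions code A)
    far = AllPairs-extensions (AllPairs.zip (prefixes-far , lengths))
                              (All.map (λ c → proj₂ (proj₂ c)) codes)

theorem8 : (n m d : ℕ) → 1 ≤ d → d ≤ n → 1 ≤ m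
    → (A : List (List ℕ)) → InQ (n + m) m d A
    → (f : List ℕ → ℕ) → (∀ σ → σ ∈ A → IsPd d (compl (n + m) σ) (f σ))
    → (p : ℕ) → IsP (n + m) d p
    → sum (map f A) ≤ p
-- The hypotheses d ≤ n and 1 ≤ m only exclude degenerate parameters; the bound holds without them.
theorem8 n m d 1≤d _ _ A A∈Q f A-Pd p (_ , P-maximal) = begin
  sum (map f A)               ≡⟨ length-extensions code A (All.map proj₂ optimal) ⟨
  length (extensions code A)  ≤⟨ P-maximal (extensions code A) code-isPermCode ⟩
  p                           ∎
  where
  open ≤-Reasoning
  chosen : Σ (List ℕ → List (List ℕ))
             (λ code → All (λ σ → IsPermCode d (compl (n + m) σ) (code σ) × length (code σ) ≡ f σ) A)
  chosen = finite-choice (≡-dec _≟_) [] A (λ σ σ∈A → proj₁ (A-Pd σ σ∈A))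
  code : List ℕ → List (List ℕ)
  code = proj₁ chosen
  optimal : All (λ σ → IsPermCode d (compl (n + m) σ) (code σ) × length (code σ) ≡ f σ) A
  optimal = proj₂ chosen
  code-isPermCode : IsPermCode d (range (n + m)) (extensions code A)
  code-isPermCode = extensions-isPermCode code 1≤d A∈Q (All.map proj₁ optimal)
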